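{- For every graph $G$, $\mathrm{lrw}(G)\le \mathrm{rd}(G)^2$.
   Context: For $S\subseteq V(G)$, the cut-rank $\rho_G(S)$ is the rank over the binary field of the $S\times (V(G)\setminus S)$ adjacency submatrix. The $\rho_G$-width of a partition $(X_1,\dots,X_m)$ of $V(G)$ is $\max\{\rho_G(\bigcup_{i\in I}X_i): I\subseteq\{1,\dots,m\}\}$. A decomposition of $G$ is a pair $(T,\sigma)$ of a tree $T$ with at least one internal node and a bijection $\sigma$ from $V(G)$ to the leaves of $T$; its radius is the radius of $T$. For an internal node $t$, the components of $T-t$ give a partition of $V(G)$, and the width of $t$ is its $\rho_G$-width; the width of $(T,\sigma)$ is the maximum over internal nodes. The rank-depth $\mathrm{rd}(G)$ is the minimum $k$ such that $G$ admits a decomposition of width at most $k$ and radius at most $k$ ($0$ if $|V(G)|<2$). The linear rank-width $\mathrm{lrw}(G)$ is the minimum over all orderings $(x_1,\dots,x_m)$ of $V(G)$ of $\max_{1\le i\le m-1}\rho_G(\{x_1,\dots,x_i\})$ (defined to be $0$ if $|V(G)|=1$). -}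

module Defs where

open import Data.Nat using (ℕ; zero; suc; _+_; _*_; _≤_; _<_; _<ᵇ_)
open import Data.Bool using (Bool; true; false; _∧_; not; _xor_; if_then_else_)
open import Data.Fin using (Fin; zero; suc; toℕ; inject₁; fromℕ)
open import Data.Fin.Permutation using (Permutation′; _⟨$⟩ˡ_)
open import Data.Product using (Σ; ∃; _×_; _,_)
open import Data.Sum using (_⊎_)
open import Relation.Binary.PropositionalEquality using (_≡_; _≢_)
open import Relation.Nullary using (¬_)
open import Function.Definitions using (Injective)

count : ∀ {n} → (Fin n → Bool) → ℕ
count {zero}  P = 0
count {suc n} P = (if P zero then 1 else 0) + count (λ i → P (suc i))

xorSum : ∀ {n} → (Fin n → Bool) → Bool
xorSum {zero}  P = false
xorSum {suc n} P = P zero xor xorSum (λ i → P (suc i))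

Subset : ℕ → Set
Subset n = Fin n → Bool

_⊆_ : ∀ {n} → Subset n → Subset n → Set
A ⊆ B = ∀ i → A i ≡ true → B i ≡ true

record Graph (n : ℕ) : Set where
  field
    adj   : Fin n → Fin n → Bool
    sym   : ∀ u v → adj u v ≡ adj v u
    irrefl : ∀ v → adj v v ≡ false
open Graph public

rowSum : ∀ {n} → (Fin n → Fin n → Bool) → Subset n → Fin n → Bool
rowSum M W w = xorSum (λ v → W v ∧ M v w)

IndepRows : ∀ {n} → (Fin n → Fin n → Bool) → Subset n → Subset n → Subset n → Set
IndepRows M R C U =
  U ⊆ R ×
  (∀ W → W ⊆ U → (∃ λ v → W v ≡ true) →
     ¬ (∀ w → C w ≡ true → rowSum M W w ≡ false))

-- rank of the R × C submatrix is at most k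
-- (rank = maximum size of a linearly independent set of rows)
RankLe : ∀ {n} → (Fin n → Fin n → Bool) → Subset n → Subset n → ℕ → Set
RankLe M R C k = ∀ U → IndepRows M R C U → count U ≤ k

CutRankLe : ∀ {n} → Graph n → Subset n → ℕ → Set
CutRankLe G S k = RankLe (adj G) S (λ v → not (S v)) k

-- Linear rank-width: lrw(G) ≤ k
-- An ordering (x_1,…,x_n) of V(G) is a permutation π with x_{j+1} = π ⟨$⟩ʳ j;
-- the prefix {x_1,…,x_i} is {v : position of v < i}.

prefix : ∀ {n} → Permutation′ n → ℕ → Subset n
prefix π i v = toℕ (π ⟨$⟩ˡ v) <ᵇ i

LrwLe : ∀ {n} → Graph n → ℕ → Set
LrwLe {n} G k =
  Σ (Permutation′ n) λ π → ∀ i → 1 ≤ i → suc i ≤ n → CutRankLe G (prefix π i) k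

data WalkLe {m} (E : Fin m → Fin m → Bool) : Fin m → Fin m → ℕ → Set where
  here : ∀ {a k} → WalkLe E a a k
  step : ∀ {a c b k} → E a c ≡ true → WalkLe E c b k → WalkLe E a b (suc k)

data ConnAvoid {m} (E : Fin m → Fin m → Bool) (t : Fin m) : Fin m → Fin m → Set where
  here : ∀ {a} → a ≢ t → ConnAvoid E t a a
  step : ∀ {a c b} → a ≢ t → E a c ≡ true → ConnAvoid E t c b → ConnAvoid E t a b

record Cycle {m} (E : Fin m → Fin m → Bool) : Set where
  field
    l     : ℕ
    f     : Fin (3 + l) → Fin m
    inj   : Injective _≡_ _≡_ f
    edges : ∀ (i : Fin (2 + l)) → E (f (inject₁ i)) (f (suc i)) ≡ true
    close : E (f (fromℕ (2 + l))) (f zero) ≡ true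

record Tree (m : ℕ) : Set where
  field
    tadj      : Fin m → Fin m → Bool
    tsym      : ∀ a b → tadj a b ≡ tadj b a
    tirrefl   : ∀ a → tadj a a ≡ false
    connected : ∀ a b → ∃ λ k → WalkLe tadj a b k
    acyclic   : ¬ Cycle tadj
open Tree public

degree : ∀ {m} → Tree m → Fin m → ℕ
degree T a = count (tadj T a)

Leaf : ∀ {m} → Tree m → Fin m → Set
Leaf T a = degree T a ≡ 1

Internal : ∀ {m} → Tree m → Fin m → Set
Internal T a = ¬ Leaf T a

RadiusLe : ∀ {m} → Tree m → ℕ → Set
RadiusLe T k = ∃ λ c → ∀ a → WalkLe (tadj T) c a k

record Decomposition {n} (G : Graph n) : Set where
  field
    m         : ℕ
    tree      : Tree m
    hasInternal : ∃ λ t → Internal tree t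
    σ         : Fin n → Fin m
    σ-inj     : Injective _≡_ _≡_ σ
    σ-leaf    : ∀ v → Leaf tree (σ v)
    σ-onto    : ∀ a → Leaf tree a → ∃ λ v → σ v ≡ a
open Decomposition public

-- S is a union of parts of the partition of V(G) induced by the
-- components of T - t (vertices u, v lie in the same part iff σ u and
-- σ v are connected in T - t)
UnionOfParts : ∀ {n} {G : Graph n} (D : Decomposition G) → Fin (m D) → Subset n → Set
UnionOfParts D t S =
  ∀ u v → ConnAvoid (tadj (tree D)) t (σ D u) (σ D v) → S u ≡ S v

NodeWidthLe : ∀ {n} {G : Graph n} (D : Decomposition G) → Fin (m D) → ℕ → Set
NodeWidthLe {G = G} D t k = ∀ S → UnionOfParts D t S → CutRankLe G S k

WidthLe : ∀ {n} {G : Graph n} → Decomposition G → ℕ → Set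
WidthLe D k = ∀ t → Internal (tree D) t → NodeWidthLe D t k

RdLe : ∀ {n} → Graph n → ℕ → Set
RdLe {n} G k = n < 2 ⊎ (Σ (Decomposition G) λ D → WidthLe D k × RadiusLe (tree D) k)

module Submission where

-- Let (T, σ) be a decomposition of width ≤ k whose tree has a centre c at
-- distance ≤ k from every node, and root T at c.  Each node a gets a key
-- (a₁, …, a_k): aⱼ is 1 + the label of the ancestor of a at depth j, or 0
-- when j exceeds the depth of a.  Vertices are ordered lexicographically
-- by the keys of their leaves.  The vertices before x form the union, over
-- j < k, of the slices "key agrees with that of x before j and is smaller
-- at j".  Such a slice is empty, or, with t the ancestor of x at depth j,
-- it consists of leaves hanging below some children of t.  Acyclicity of T
-- forces every edge to join a node to its parent, so the slice is a union
-- of components of T − t and has cut-rank ≤ k (or is a single vertex when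
-- t is a leaf).  Independent rows for a prefix restrict to independent rows
-- for each slice, so every prefix has cut-rank ≤ k · k.

open import Defs hiding (sym)
open import Data.Nat using (ℕ; zero; suc; _+_; _*_; _∸_; _≤_; _<_; _<ᵇ_; z≤n; s≤s; z<s)
open import Data.Nat.Properties
open import Data.Bool using (Bool; true; false; _∧_; _∨_; not; if_then_else_) renaming (_≟_ to _≟ᵇ_)
open import Data.Fin using (Fin; zero; suc; toℕ; fromℕ<; punchOut)
open import Data.Fin.Properties
  using (any?; punchOut-injective; injective⇒≤; toℕ-fromℕ<; toℕ-injective; toℕ<n; toℕ-inject₁; toℕ-fromℕ)
  renaming (_≟_ to _≟ᶠ_; suc-injective to Fin-suc-injective)
open import Data.Fin.Permutation using (Permutation′; permutation) renaming (id to identity)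
open import Data.Product using (Σ; ∃; _×_; _,_; proj₁; proj₂)
open import Data.Sum using (_⊎_; inj₁; inj₂)
open import Data.Empty using (⊥; ⊥-elim)
open import Relation.Binary.PropositionalEquality
open import Relation.Nullary using (¬_; Dec; yes; no; does)
open import Relation.Binary using (tri<; tri≈; tri>)
open import Function.Definitions using (Injective)
open import Function using (_∘_)

true≢false : ∀ {b} → b ≡ true → b ≡ false → ⊥
true≢false refl ()

not-true : ∀ {b} → not b ≡ true → b ≡ false
not-true {false} _ = refl

not-false : ∀ {b} → b ≡ false → not b ≡ true
not-false refl = refl

¬true⇒false : ∀ {b} → ¬ (b ≡ true) → b ≡ false
¬true⇒false {true}  h = ⊥-elim (h refl)
¬true⇒false {false} _ = refl

∧-projˡ : ∀ {a b} → a ∧ b ≡ true → a ≡ true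
∧-projˡ {true} _ = refl

∧-projʳ : ∀ {a b} → a ∧ b ≡ true → b ≡ true
∧-projʳ {true} e = e

∧-intro : ∀ {a b} → a ≡ true → b ≡ true → a ∧ b ≡ true
∧-intro refl refl = refl

∨-injˡ : ∀ {a b} → a ≡ true → a ∨ b ≡ true
∨-injˡ refl = refl

∨-injʳ : ∀ {a b} → b ≡ true → a ∨ b ≡ true
∨-injʳ {true}  _ = refl
∨-injʳ {false} e = e

∨-elim : ∀ {a b} → a ∨ b ≡ true → a ≡ true ⊎ b ≡ true
∨-elim {true}  _ = inj₁ refl
∨-elim {false} e = inj₂ e

bool-ext : ∀ {a b} → (a ≡ true → b ≡ true) → (b ≡ true → a ≡ true) → a ≡ b
bool-ext {true}  {true}  _ _ = refl
bool-ext {true}  {false} f _ = sym (f refl)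
bool-ext {false} {true}  _ g = g refl
bool-ext {false} {false} _ _ = refl

does-sound : ∀ {P : Set} (d : Dec P) → does d ≡ true → P
does-sound (yes p) _ = p

does-complete : ∀ {P : Set} (d : Dec P) → P → does d ≡ true
does-complete (yes _) _ = refl
does-complete (no ¬p) p = ⊥-elim (¬p p)

does-false : ∀ {P : Set} (d : Dec P) → ¬ P → does d ≡ false
does-false d ¬p = ¬true⇒false (λ e → ¬p (does-sound d e))

_==_ : ∀ {m} → Fin m → Fin m → Bool
a == b = does (a ≟ᶠ b)

count-mono : ∀ {n} (P Q : Subset n) → P ⊆ Q → count P ≤ count Q
count-mono {zero}  P Q h = z≤n
count-mono {suc n} P Q h with P zero in eP | Q zero in eQ
... | true  | true  = s≤s (count-mono _ _ (λ i → h (suc i)))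
... | false | true  = m≤n⇒m≤1+n (count-mono _ _ (λ i → h (suc i)))
... | false | false = count-mono _ _ (λ i → h (suc i))
... | true  | false = ⊥-elim (true≢false (h zero eP) eQ)

count-strict : ∀ {n} (P Q : Subset n) → P ⊆ Q →
  ∀ a → Q a ≡ true → P a ≡ false → count P < count Q
count-strict {suc n} P Q h zero qa pa rewrite qa | pa = s≤s (count-mono _ _ (λ i → h (suc i)))
count-strict {suc n} P Q h (suc a) qa pa with P zero in eP | Q zero in eQ
... | true  | true  = s≤s (count-strict _ _ (λ i → h (suc i)) a qa pa)
... | false | true  = m<n⇒m<1+n (count-strict _ _ (λ i → h (suc i)) a qa pa)
... | false | false = count-strict _ _ (λ i → h (suc i)) a qa pa
... | true  | false = ⊥-elim (true≢false (h zero eP) eQ)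

count-full : ∀ n → count {n} (λ _ → true) ≡ n
count-full zero    = refl
count-full (suc n) = cong suc (count-full n)

count-<n : ∀ {n} (P : Subset n) a → P a ≡ false → count P < n
count-<n {n} P a pa =
  subst (count P <_) (count-full n) (count-strict P (λ _ → true) (λ _ _ → refl) a refl pa)

count-empty : ∀ {n} (P : Subset n) → (∀ i → P i ≡ false) → count P ≡ 0
count-empty {zero}  P h = refl
count-empty {suc n} P h rewrite h zero = count-empty _ (λ i → h (suc i))

count-pair : ∀ {n} (P : Subset n) a b → P a ≡ true → P b ≡ true → a ≢ b → 2 ≤ count P
count-pair P zero    zero    _  _  ne = ⊥-elim (ne refl)
count-pair P zero    (suc b) pa pb _  rewrite pa =
  s≤s (≤-trans z<s (count-strict (λ _ → false) _ (λ _ ()) b pb refl))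
count-pair P (suc a) zero    pa pb _  rewrite pb =
  s≤s (≤-trans z<s (count-strict (λ _ → false) _ (λ _ ()) a pa refl))
count-pair {suc n} P (suc a) (suc b) pa pb ne =
  ≤-trans (count-pair (λ i → P (suc i)) a b pa pb (λ e → ne (cong suc e))) (m≤n+m _ _)

count-subsingleton : ∀ {n} (P : Subset n) → (∀ a b → P a ≡ true → P b ≡ true → a ≡ b) → count P ≤ 1
count-subsingleton {zero}  P h = z≤n
count-subsingleton {suc n} P h with P zero in e
... | true  = s≤s (≤-reflexive (count-empty _ (λ i → ¬true⇒false (λ pi → zero≢suc (h zero (suc i) e pi)))))
  where
  zero≢suc : ∀ {i : Fin n} → ¬ (Fin.zero ≡ suc i)
  zero≢suc ()
... | false = count-subsingleton _ (λ a b pa pb → Fin-suc-injective (h (suc a) (suc b) pa pb))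

count-split : ∀ {n} (U B : Subset n) → count U ≤ count (λ v → U v ∧ B v) + count (λ v → U v ∧ not (B v))
count-split {zero}  U B = z≤n
count-split {suc n} U B with U zero | B zero
... | true  | true  = s≤s (count-split (λ i → U (suc i)) (λ i → B (suc i)))
... | true  | false = ≤-trans (s≤s (count-split (λ i → U (suc i)) (λ i → B (suc i)))) (≤-reflexive (sym (+-suc _ _)))
... | false | _     = count-split (λ i → U (suc i)) (λ i → B (suc i))

-- Bounded least search: `least f N` is the least j with f j, provided f N.

least : (ℕ → Bool) → ℕ → ℕ
least f zero    = zero
least f (suc N) = if f 0 then 0 else suc (least (λ i → f (suc i)) N)

least-holds : ∀ (f : ℕ → Bool) N → f N ≡ true → f (least f N) ≡ true
least-holds f zero    e = e
least-holds f (suc N) e with f 0 in e0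
... | true  = e0
... | false = least-holds (λ i → f (suc i)) N e

least-minimal : ∀ (f : ℕ → Bool) N j → j < least f N → f j ≡ false
least-minimal f (suc N) j lt with f 0 in e0
least-minimal f (suc N) zero    lt       | false = e0
least-minimal f (suc N) (suc j) (s≤s lt) | false = least-minimal (λ i → f (suc i)) N j lt

least-≤ : ∀ (f : ℕ → Bool) N j → f j ≡ true → least f N ≤ j
least-≤ f N j e = ≮⇒≥ (λ lt → true≢false e (least-minimal f N j lt))

least-bounded : ∀ (f : ℕ → Bool) N → least f N ≤ N
least-bounded f zero    = z≤n
least-bounded f (suc N) with f 0
... | true  = z≤n
... | false = s≤s (least-bounded _ N)

lex : ℕ → (ℕ → ℕ) → (ℕ → ℕ) → Bool
lex zero    f g = false
lex (suc K) f g = does (f 0 <? g 0) ∨ (does (f 0 ≟ g 0) ∧ lex K (λ i → f (suc i)) (λ i → g (suc i)))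

agree : ℕ → (ℕ → ℕ) → (ℕ → ℕ) → Bool
agree zero    f g = true
agree (suc j) f g = does (f 0 ≟ g 0) ∧ agree j (λ i → f (suc i)) (λ i → g (suc i))

agree-sound : ∀ j f g → agree j f g ≡ true → ∀ q → q < j → f q ≡ g q
agree-sound (suc j) f g e zero    _        = does-sound (f 0 ≟ g 0) (∧-projˡ e)
agree-sound (suc j) f g e (suc q) (s≤s lt) = agree-sound j _ _ (∧-projʳ e) q lt

agree-complete : ∀ j f g → (∀ q → q < j → f q ≡ g q) → agree j f g ≡ true
agree-complete zero    f g h = refl
agree-complete (suc j) f g h =
  ∧-intro (does-complete (f 0 ≟ g 0) (h 0 z<s)) (agree-complete j _ _ (λ q lt → h (suc q) (s≤s lt)))

lex-irrefl : ∀ K f → lex K f f ≡ false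
lex-irrefl zero    f = refl
lex-irrefl (suc K) f
  rewrite does-false (f 0 <? f 0) (<-irrefl refl) | does-complete (f 0 ≟ f 0) refl = lex-irrefl K _

lex-trans : ∀ K f g h → lex K f g ≡ true → lex K g h ≡ true → lex K f h ≡ true
lex-trans (suc K) f g h e₁ e₂ with ∨-elim {does (f 0 <? g 0)} e₁ | ∨-elim {does (g 0 <? h 0)} e₂
... | inj₁ a | inj₁ b = ∨-injˡ (does-complete (f 0 <? h 0) (<-trans (does-sound (f 0 <? g 0) a) (does-sound (g 0 <? h 0) b)))
... | inj₁ a | inj₂ b = ∨-injˡ (does-complete (f 0 <? h 0)
                          (subst (f 0 <_) (does-sound (g 0 ≟ h 0) (∧-projˡ b)) (does-sound (f 0 <? g 0) a)))
... | inj₂ a | inj₁ b = ∨-injˡ (does-complete (f 0 <? h 0)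
                          (subst (_< h 0) (sym (does-sound (f 0 ≟ g 0) (∧-projˡ a))) (does-sound (g 0 <? h 0) b)))
... | inj₂ a | inj₂ b = ∨-injʳ {does (f 0 <? h 0)}
  (∧-intro (does-complete (f 0 ≟ h 0) (trans (does-sound (f 0 ≟ g 0) (∧-projˡ a)) (does-sound (g 0 ≟ h 0) (∧-projˡ b))))
           (lex-trans K _ _ _ (∧-projʳ a) (∧-projʳ b)))

lex-total : ∀ K f g q → q < K → f q ≢ g q → lex K f g ≡ true ⊎ lex K g f ≡ true
lex-total (suc K) f g q q<K ne with <-cmp (f 0) (g 0)
... | tri< a _ _ = inj₁ (∨-injˡ (does-complete (f 0 <? g 0) a))
... | tri> _ _ c = inj₂ (∨-injˡ (does-complete (g 0 <? f 0) c))
lex-total (suc K) f g zero    _          ne | tri≈ _ b _ = ⊥-elim (ne b)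
lex-total (suc K) f g (suc q) (s≤s q<K) ne | tri≈ _ b _
  with lex-total K (λ i → f (suc i)) (λ i → g (suc i)) q q<K ne
... | inj₁ x = inj₁ (∨-injʳ {does (f 0 <? g 0)} (∧-intro (does-complete (f 0 ≟ g 0) b) x))
... | inj₂ x = inj₂ (∨-injʳ {does (g 0 <? f 0)} (∧-intro (does-complete (g 0 ≟ f 0) (sym b)) x))

lex-split : ∀ K f g → lex K f g ≡ true →
  Σ ℕ λ j → j < K × agree j f g ≡ true × (f j <ᵇ g j) ≡ true
lex-split (suc K) f g e with ∨-elim {does (f 0 <? g 0)} e
... | inj₁ a = 0 , z<s , refl , a
... | inj₂ a with lex-split K _ _ (∧-projʳ a)
... | j , j<K , ag , lt = suc j , s≤s j<K , ∧-intro (∧-projˡ a) ag , lt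

lex-join : ∀ K f g j → j < K → agree j f g ≡ true → (f j <ᵇ g j) ≡ true → lex K f g ≡ true
lex-join (suc K) f g zero    _          _  lt = ∨-injˡ lt
lex-join (suc K) f g (suc j) (s≤s j<K) ag lt =
  ∨-injʳ {does (f 0 <? g 0)} (∧-intro (∧-projˡ ag) (lex-join K _ _ j j<K (∧-projʳ ag) lt))

injective⇒surjective : ∀ {n} (f : Fin n → Fin n) → Injective _≡_ _≡_ f → ∀ j → ∃ λ i → f i ≡ j
injective⇒surjective {suc n} f inj j with any? (λ i → f i ≟ᶠ j)
... | yes hit = hit
... | no miss = ⊥-elim (<-irrefl refl (injective⇒≤ {f = g} g-inj))
  where
  f≢j : ∀ i → j ≢ f i
  f≢j i e = miss (i , sym e)
  -- f avoids j, so it factors injectively through Fin n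
  g : Fin (suc n) → Fin n
  g i = punchOut (f≢j i)
  g-inj : Injective _≡_ _≡_ g
  g-inj {x} {y} e = inj (punchOut-injective (f≢j x) (f≢j y) e)

-- A strict total order on Fin n, given as a boolean relation, is realised
-- by an ordering of Fin n: the vertices of each prefix are exactly those
-- below some x.
module OrderingFrom {n} (lt : Fin n → Fin n → Bool)
  (lt-irrefl : ∀ u → lt u u ≡ false)
  (lt-trans  : ∀ u v w → lt u v ≡ true → lt v w ≡ true → lt u w ≡ true)
  (lt-total  : ∀ u v → u ≢ v → lt u v ≡ true ⊎ lt v u ≡ true) where

  rankℕ : Fin n → ℕ
  rankℕ v = count (λ u → lt u v)

  rank : Fin n → Fin n
  rank v = fromℕ< (count-<n (λ u → lt u v) v (lt-irrefl v))

  toℕ-rank : ∀ v → toℕ (rank v) ≡ rankℕ v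
  toℕ-rank v = toℕ-fromℕ< _

  rank-mono : ∀ u v → lt u v ≡ true → rankℕ u < rankℕ v
  rank-mono u v h = count-strict _ _ (λ w e → lt-trans w u v e h) u h (lt-irrefl u)

  rank-inj : Injective _≡_ _≡_ rank
  rank-inj {u} {v} e with u ≟ᶠ v
  ... | yes p = p
  ... | no u≢v with lt-total u v u≢v
  ... | inj₁ h = ⊥-elim (<⇒≢ (rank-mono u v h) (trans (sym (toℕ-rank u)) (trans (cong toℕ e) (toℕ-rank v))))
  ... | inj₂ h = ⊥-elim (<⇒≢ (rank-mono v u h) (trans (sym (toℕ-rank v)) (trans (cong toℕ (sym e)) (toℕ-rank u))))

  unrank : Fin n → Fin n
  unrank j = proj₁ (injective⇒surjective rank rank-inj j)

  rank-unrank : ∀ j → rank (unrank j) ≡ j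
  rank-unrank j = proj₂ (injective⇒surjective rank rank-inj j)

  ordering : Permutation′ n
  ordering = permutation unrank rank (λ u → rank-inj (rank-unrank (rank u))) rank-unrank

  prefix-downset : ∀ i → i < n → ∃ λ x → ∀ v → prefix ordering i v ≡ lt v x
  prefix-downset i i<n = x , λ v → bool-ext (below v) (above v)
    where
    x = unrank (fromℕ< i<n)
    rank-x : rankℕ x ≡ i
    rank-x = trans (sym (toℕ-rank x)) (trans (cong toℕ (rank-unrank _)) (toℕ-fromℕ< i<n))
    below : ∀ v → (toℕ (rank v) <ᵇ i) ≡ true → lt v x ≡ true
    below v e with lt v x in h
    ... | true = refl
    ... | false with v ≟ᶠ x
    ... | yes refl = ⊥-elim (<-irrefl (trans (toℕ-rank v) rank-x) (does-sound (_ <? i) e))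
    ... | no v≢x with lt-total v x v≢x
    ... | inj₁ h' = ⊥-elim (true≢false h' h)
    ... | inj₂ h' = ⊥-elim (<-asym (does-sound (_ <? i) e) (subst₂ _<_ rank-x (sym (toℕ-rank v)) (rank-mono x v h')))
    above : ∀ v → lt v x ≡ true → (toℕ (rank v) <ᵇ i) ≡ true
    above v h = does-complete (_ <? i) (subst₂ _<_ (sym (toℕ-rank v)) rank-x (rank-mono v x h))

cutRank-≤-size : ∀ {n} (G : Graph n) (S : Subset n) b → count S ≤ b → CutRankLe G S b
cutRank-≤-size G S b le U (U⊆S , _) = ≤-trans (count-mono U S U⊆S) le

-- Rows independent for the cut (P, ∁P) stay independent for a cut (A, ∁A)
-- with A ⊆ P, because ∁A ⊇ ∁P offers more columns.
indep-restrict : ∀ {n} (M : Fin n → Fin n → Bool) (P A U : Subset n) → A ⊆ P →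
  IndepRows M P (λ v → not (P v)) U → IndepRows M A (λ v → not (A v)) (λ v → U v ∧ A v)
indep-restrict M P A U A⊆P (_ , indep) = (λ i e → ∧-projʳ e) , λ W W⊆ nonempty vanish →
  indep W (λ i e → ∧-projˡ (W⊆ i e)) nonempty
    (λ w w∉P → vanish w (not-false (¬true⇒false (λ w∈A → true≢false (A⊆P w w∈A) (not-true w∉P)))))

count-cover : ∀ {n} (A : ℕ → Subset n) b K (U : Subset n) →
  (∀ v → U v ≡ true → Σ ℕ λ j → j < K × A j v ≡ true) →
  (∀ j → j < K → count (λ v → U v ∧ A j v) ≤ b) → count U ≤ K * b
count-cover A b zero U cover _ =
  ≤-reflexive (count-empty U (λ v → ¬true⇒false (λ e → no-index (cover v e))))
  where
  no-index : ∀ {B : ℕ → Set} → (Σ ℕ λ j → j < 0 × B j) → ⊥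
  no-index (_ , () , _)
count-cover A b (suc K) U cover meet =
  ≤-trans (count-split U (A K)) (+-mono-≤ (meet K ≤-refl) (count-cover A b K U′ cover′ meet′))
  where
  U′ : Subset _
  U′ v = U v ∧ not (A K v)
  cover′ : ∀ v → U′ v ≡ true → Σ ℕ λ j → j < K × A j v ≡ true
  cover′ v e with cover v (∧-projˡ e)
  ... | j , j<1+K , Ajv with j ≟ K
  ... | yes refl = ⊥-elim (true≢false Ajv (not-true (∧-projʳ e)))
  ... | no j≢K   = j , ≤∧≢⇒< (≤-pred j<1+K) j≢K , Ajv
  meet′ : ∀ j → j < K → count (λ v → U′ v ∧ A j v) ≤ b
  meet′ j j<K = ≤-trans (count-mono (λ v → U′ v ∧ A j v) (λ v → U v ∧ A j v)
                          (λ v e → ∧-intro (∧-projˡ {U v} (∧-projˡ {U′ v} e)) (∧-projʳ {U′ v} e)))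
                        (meet j (m<n⇒m<1+n j<K))

cutRank-cover : ∀ {n} (G : Graph n) (P : Subset n) (A : ℕ → Subset n) K b →
  (∀ j → j < K → A j ⊆ P) →
  (∀ v → P v ≡ true → Σ ℕ λ j → j < K × A j v ≡ true) →
  (∀ j → j < K → CutRankLe G (A j) b) → CutRankLe G P (K * b)
cutRank-cover G P A K b A⊆P cover rank-A U (U⊆P , indep) =
  count-cover A b K U (λ v e → cover v (U⊆P v e))
    (λ j j<K → rank-A j j<K _ (indep-restrict (adj G) P (A j) U (A⊆P j j<K) (U⊆P , indep)))

∸-suc : ∀ {D j} → j < D → D ∸ j ≡ suc (D ∸ suc j)
∸-suc lt = +-∸-assoc 1 lt

-- A tree T of radius ≤ k, rooted at a centre c.  We compute depths (BFS
-- levels), a parent function and ancestors at each depth.  Acyclicity is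
-- not used here; it enters in `edge-parent` below.
module RootedTree {m} (T : Tree m) (c : Fin m) (k : ℕ) (radius : ∀ a → WalkLe (tadj T) c a k) where

  E : Fin m → Fin m → Bool
  E = tadj T

  E-sym : ∀ {a b} → E a b ≡ true → E b a ≡ true
  E-sym {a} {b} e = trans (tsym T b a) e

  walk-snoc : ∀ {a b d j} → WalkLe E a b j → E b d ≡ true → WalkLe E a d (suc j)
  walk-snoc here       e′ = step e′ here
  walk-snoc (step e w) e′ = step e (walk-snoc w e′)

  walk-reverse : ∀ {a b j} → WalkLe E a b j → WalkLe E b a j
  walk-reverse here       = here
  walk-reverse (step e w) = walk-snoc (walk-reverse w) (E-sym e)

  reach : ℕ → Fin m → Bool
  reach zero    a = a == c
  reach (suc j) a = (a == c) ∨ does (any? (λ b → (E a b ∧ reach j b) ≟ᵇ true))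

  reach-centre : ∀ j → reach j c ≡ true
  reach-centre zero    = does-complete (c ≟ᶠ c) refl
  reach-centre (suc j) = ∨-injˡ (does-complete (c ≟ᶠ c) refl)

  walk⇒reach : ∀ {a j} → WalkLe E a c j → reach j a ≡ true
  walk⇒reach {j = j} here = reach-centre j
  walk⇒reach {a} (step {c = b} e w) =
    ∨-injʳ {a == c} (does-complete (any? _) (b , ∧-intro e (walk⇒reach w)))

  depth : Fin m → ℕ
  depth a = least (λ j → reach j a) k

  depth-reach : ∀ a → reach (depth a) a ≡ true
  depth-reach a = least-holds (λ j → reach j a) k (walk⇒reach (walk-reverse (radius a)))

  depth-minimal : ∀ a j → reach j a ≡ true → depth a ≤ j
  depth-minimal a j e = least-≤ (λ j → reach j a) k j e

  depth-≤k : ∀ a → depth a ≤ k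
  depth-≤k a = least-bounded (λ j → reach j a) k

  depth-centre : depth c ≡ 0
  depth-centre = n≤0⇒n≡0 (depth-minimal c 0 (reach-centre 0))

  depth-zero : ∀ a → depth a ≡ 0 → a ≡ c
  depth-zero a e = does-sound (a ≟ᶠ c) (subst (λ j → reach j a ≡ true) e (depth-reach a))

  non-centre : ∀ a → depth a ≢ 0 → a ≢ c
  non-centre a ne refl = ne depth-centre

  edge-depth : ∀ a b → E a b ≡ true → depth a ≤ suc (depth b)
  edge-depth a b e = depth-minimal a (suc (depth b))
    (∨-injʳ {a == c} (does-complete (any? _) (b , ∧-intro e (depth-reach b))))

  closer-neighbour : ∀ a → a ≢ c → Σ (Fin m) λ b → E a b ∧ reach (depth a ∸ 1) b ≡ true
  closer-neighbour a ne with depth a in eq | depth-reach a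
  ... | zero  | _ = ⊥-elim (ne (depth-zero a eq))
  ... | suc d | r with ∨-elim {a == c} r
  ... | inj₁ a≡c = ⊥-elim (ne (does-sound (a ≟ᶠ c) a≡c))
  ... | inj₂ hit = does-sound (any? _) hit

  parent : Fin m → Fin m
  parent a with a ≟ᶠ c
  ... | yes _ = c
  ... | no ne = proj₁ (closer-neighbour a ne)

  parent-centre : parent c ≡ c
  parent-centre with c ≟ᶠ c
  ... | yes _ = refl
  ... | no ne = ⊥-elim (ne refl)

  parent-spec : ∀ a → a ≢ c → E a (parent a) ∧ reach (depth a ∸ 1) (parent a) ≡ true
  parent-spec a ne with a ≟ᶠ c
  ... | yes e  = ⊥-elim (ne e)
  ... | no ne′ = proj₂ (closer-neighbour a ne′)

  parent-adj : ∀ a → a ≢ c → E a (parent a) ≡ true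
  parent-adj a ne = ∧-projˡ (parent-spec a ne)

  depth-parent : ∀ a → depth (parent a) ≡ depth a ∸ 1
  depth-parent a = by-cases a (a ≟ᶠ c)
    where
    by-cases : ∀ a → Dec (a ≡ c) → depth (parent a) ≡ depth a ∸ 1
    by-cases a (yes refl) = trans (cong depth parent-centre) (trans depth-centre (cong (_∸ 1) (sym depth-centre)))
    by-cases a (no ne)    = ≤-antisym (depth-minimal (parent a) _ (∧-projʳ {E a (parent a)} (parent-spec a ne)))
                                      (∸-monoˡ-≤ 1 (edge-depth a (parent a) (parent-adj a ne)))

  depth-suc-parent : ∀ a → a ≢ c → depth a ≡ suc (depth (parent a))
  depth-suc-parent a ne with depth a in eq
  ... | zero  = ⊥-elim (ne (depth-zero a eq))
  ... | suc d = cong suc (sym (trans (depth-parent a) (cong (_∸ 1) eq)))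

  up : ℕ → Fin m → Fin m
  up zero    a = a
  up (suc p) a = up p (parent a)

  up-suc : ∀ p a → up (suc p) a ≡ parent (up p a)
  up-suc zero    a = refl
  up-suc (suc p) a = up-suc p (parent a)

  up-+ : ∀ p q a → up (p + q) a ≡ up q (up p a)
  up-+ zero    q a = refl
  up-+ (suc p) q a = up-+ p q (parent a)

  depth-up : ∀ p a → depth (up p a) ≡ depth a ∸ p
  depth-up zero    a = refl
  depth-up (suc p) a = trans (depth-up p (parent a)) (trans (cong (_∸ p) (depth-parent a)) (∸-+-assoc (depth a) 1 p))

  -- ancestor a j: the ancestor of a at depth j (for j ≤ depth a)
  ancestor : Fin m → ℕ → Fin m
  ancestor a j = up (depth a ∸ j) a

  depth-ancestor : ∀ a j → j ≤ depth a → depth (ancestor a j) ≡ j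
  depth-ancestor a j le = trans (depth-up (depth a ∸ j) a) (m∸[m∸n]≡n le)

  ancestor-self : ∀ a → ancestor a (depth a) ≡ a
  ancestor-self a = cong (λ p → up p a) (n∸n≡0 (depth a))

  ancestor-zero : ∀ a → ancestor a 0 ≡ c
  ancestor-zero a = depth-zero _ (depth-ancestor a 0 z≤n)

  ancestor-ancestor : ∀ a q i → q ≤ i → i ≤ depth a → ancestor (ancestor a i) q ≡ ancestor a q
  ancestor-ancestor a q i q≤i i≤D = begin
      up (depth (ancestor a i) ∸ q) (ancestor a i) ≡⟨ cong (λ d → up (d ∸ q) (ancestor a i)) (depth-ancestor a i i≤D) ⟩
      up (i ∸ q) (up (depth a ∸ i) a)              ≡⟨ sym (up-+ (depth a ∸ i) (i ∸ q) a) ⟩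
      up ((depth a ∸ i) + (i ∸ q)) a              ≡⟨ cong (λ p → up p a) steps ⟩
      up (depth a ∸ q) a                          ∎
    where
    open ≡-Reasoning
    steps : (depth a ∸ i) + (i ∸ q) ≡ depth a ∸ q
    steps = trans (sym (+-∸-assoc (depth a ∸ i) q≤i)) (cong (_∸ q) (m∸n+n≡m i≤D))

  ancestor-parent : ∀ a i → a ≢ c → i ≤ depth (parent a) → ancestor a i ≡ ancestor (parent a) i
  ancestor-parent a i ne le =
    trans (cong (λ d → up (d ∸ i) a) (depth-suc-parent a ne)) (cong (λ p → up p a) (+-∸-assoc 1 le))

  parent-ancestor : ∀ a j → suc j ≤ depth a → parent (ancestor a (suc j)) ≡ ancestor a j
  parent-ancestor a j le = sym (trans (cong (λ p → up p a) (∸-suc le)) (up-suc (depth a ∸ suc j) a))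

  ancestor-adj : ∀ a j → suc j ≤ depth a → E (ancestor a j) (ancestor a (suc j)) ≡ true
  ancestor-adj a j le = E-sym (subst (λ z → E w z ≡ true) (parent-ancestor a j le)
                          (parent-adj w (non-centre w (λ z → 0≢1+n (trans (sym z) (depth-ancestor a (suc j) le))))))
    where
    w = ancestor a (suc j)

closed-walk⇒cycle : ∀ {m} (E : Fin m → Fin m → Bool) l (g : ℕ → Fin m) →
  (∀ p q → p ≤ 2 + l → q ≤ 2 + l → g p ≡ g q → p ≡ q) →
  (∀ p → p < 2 + l → E (g p) (g (suc p)) ≡ true) →
  E (g (2 + l)) (g 0) ≡ true → Cycle E
closed-walk⇒cycle E l g g-inj g-edge g-close = record
  { l     = l
  ; f     = λ a → g (toℕ a)
  ; inj   = λ {a} {b} e → toℕ-injective (g-inj _ _ (≤-pred (toℕ<n a)) (≤-pred (toℕ<n b)) e)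
  ; edges = λ i → subst (λ z → E (g z) (g (suc (toℕ i))) ≡ true) (sym (toℕ-inject₁ i)) (g-edge _ (toℕ<n i))
  ; close = subst (λ z → E (g z) (g 0) ≡ true) (sym (toℕ-fromℕ _)) g-close
  }

module TreeEdges {m} (T : Tree m) (c : Fin m) (k : ℕ) (radius : ∀ a → WalkLe (tadj T) c a k) where
  open RootedTree T c k radius

  -- Two distinct nodes u, v of equal depth D whose ancestor chains first
  -- meet i = suc i′ steps up.  The walk up from u to the meeting point and
  -- down to v visits 2i + 1 distinct nodes; positions past 2i hold `beyond`,
  -- a node used to close a cycle through a deeper common neighbour.
  module UpDownWalk (u v beyond : Fin m) (i′ : ℕ)
     (same-depth : depth v ≡ depth u) (i≤D : suc i′ ≤ depth u)
     (meet : up (suc i′) u ≡ up (suc i′) v)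
     (first-meet : ∀ j → j < suc i′ → up j u ≢ up j v) where

    i D : ℕ
    i = suc i′
    D = depth u

    2i≡ : i + i ≡ 2 + (i′ + i′)
    2i≡ = cong suc (+-suc i′ i′)

    walk : ℕ → Fin m
    walk p = if does (p ≤? i) then up p u else (if does (p ≤? i + i) then up (i + i ∸ p) v else beyond)

    walk-up : ∀ p → p ≤ i → walk p ≡ up p u
    walk-up p le rewrite does-complete (p ≤? i) le = refl

    walk-down : ∀ p → i < p → p ≤ i + i → walk p ≡ up (i + i ∸ p) v
    walk-down p lt le rewrite does-false (p ≤? i) (<⇒≱ lt) | does-complete (p ≤? i + i) le = refl

    walk-beyond : walk (suc (i + i)) ≡ beyond
    walk-beyond rewrite does-false (suc (i + i) ≤? i) (<⇒≱ (s≤s (m≤m+n i i)))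
                      | does-false (suc (i + i) ≤? i + i) (<⇒≱ ≤-refl) = refl

    walk-start : walk 0 ≡ u
    walk-start = walk-up 0 z≤n

    walk-end : walk (i + i) ≡ v
    walk-end = trans (walk-down (i + i) (s≤s (m≤n+m (suc i′) i′)) ≤-refl) (cong (λ z → up z v) (n∸n≡0 (i + i)))

    -- the meeting point is reached from both sides
    walk-down′ : ∀ p → i ≤ p → p ≤ i + i → walk p ≡ up (i + i ∸ p) v
    walk-down′ p i≤p le with p ≟ i
    ... | yes refl = trans (walk-up i ≤-refl) (trans meet (cong (λ z → up z v) (sym (m+n∸n≡m i i))))
    ... | no p≢i   = walk-down p (≤∧≢⇒< i≤p (λ e → p≢i (sym e))) le

    down-index< : ∀ q → i < q → q ≤ i + i → i + i ∸ q < i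
    down-index< q i<q le = subst (i + i ∸ q <_) (m+n∸n≡m i i) (∸-monoʳ-< i<q le)

    depth-walk-up : ∀ p → p ≤ i → depth (walk p) ≡ D ∸ p
    depth-walk-up p le = trans (cong depth (walk-up p le)) (depth-up p u)

    depth-walk-down : ∀ p → i < p → p ≤ i + i → depth (walk p) ≡ D ∸ (i + i ∸ p)
    depth-walk-down p lt le =
      trans (cong depth (walk-down p lt le)) (trans (depth-up (i + i ∸ p) v) (cong (_∸ (i + i ∸ p)) same-depth))

    depth-walk-≤ : ∀ p → p ≤ i + i → depth (walk p) ≤ D
    depth-walk-≤ p le with p ≤? i
    ... | yes p≤i = ≤-trans (≤-reflexive (depth-walk-up p p≤i)) (m∸n≤m D p)
    ... | no p≰i  = ≤-trans (≤-reflexive (depth-walk-down p (≰⇒> p≰i) le)) (m∸n≤m D (i + i ∸ p))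

    -- a node on the way up never reappears on the way down: equal depths
    -- would give equal distances from u and v, contradicting `first-meet`
    up≢down : ∀ p q → p ≤ i → i < q → q ≤ i + i → walk p ≢ walk q
    up≢down p q p≤i i<q q≤2i e =
      first-meet p p<i (trans (sym (walk-up p p≤i)) (trans e (trans (walk-down q i<q q≤2i) (cong (λ z → up z v) (sym p≡)))))
      where
      p≡ : p ≡ i + i ∸ q
      p≡ = ∸-cancelˡ-≡ (≤-trans p≤i i≤D) (≤-trans (<⇒≤ (down-index< q i<q q≤2i)) i≤D)
             (trans (sym (depth-walk-up p p≤i)) (trans (cong depth e) (depth-walk-down q i<q q≤2i)))
      p<i : p < i
      p<i = subst (_< i) (sym p≡) (down-index< q i<q q≤2i)

    walk-injective : ∀ p q → p ≤ i + i → q ≤ i + i → walk p ≡ walk q → p ≡ q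
    walk-injective p q p≤2i q≤2i e with p ≤? i | q ≤? i
    ... | yes p≤i | yes q≤i = ∸-cancelˡ-≡ (≤-trans p≤i i≤D) (≤-trans q≤i i≤D)
                                (trans (sym (depth-walk-up p p≤i)) (trans (cong depth e) (depth-walk-up q q≤i)))
    ... | yes p≤i | no q≰i  = ⊥-elim (up≢down p q p≤i (≰⇒> q≰i) q≤2i e)
    ... | no p≰i  | yes q≤i = ⊥-elim (up≢down q p q≤i (≰⇒> p≰i) p≤2i (sym e))
    ... | no p≰i  | no q≰i  = ∸-cancelˡ-≡ p≤2i q≤2i
          (∸-cancelˡ-≡ (≤-trans (<⇒≤ (down-index< p (≰⇒> p≰i) p≤2i)) i≤D)
                       (≤-trans (<⇒≤ (down-index< q (≰⇒> q≰i) q≤2i)) i≤D)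
             (trans (sym (depth-walk-down p (≰⇒> p≰i) p≤2i)) (trans (cong depth e) (depth-walk-down q (≰⇒> q≰i) q≤2i))))

    to-parent : ∀ a → depth a ≢ 0 → E a (parent a) ≡ true
    to-parent a ne = parent-adj a (non-centre a ne)

    step-up : ∀ p → suc p ≤ i → walk (suc p) ≡ parent (walk p)
    step-up p sp≤i =
      trans (walk-up (suc p) sp≤i) (trans (up-suc p u) (cong parent (sym (walk-up p (≤-trans (n≤1+n p) sp≤i)))))

    step-down : ∀ p → i < suc p → suc p ≤ i + i → walk p ≡ parent (walk (suc p))
    step-down p i<sp sp≤2i = begin
      walk p                          ≡⟨ walk-down′ p (≤-pred i<sp) (≤-trans (n≤1+n p) sp≤2i) ⟩
      up (i + i ∸ p) v                ≡⟨ cong (λ z → up z v) (∸-suc sp≤2i) ⟩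
      up (suc (i + i ∸ suc p)) v      ≡⟨ up-suc (i + i ∸ suc p) v ⟩
      parent (up (i + i ∸ suc p) v)   ≡⟨ cong parent (sym (walk-down (suc p) i<sp sp≤2i)) ⟩
      parent (walk (suc p))           ∎
      where open ≡-Reasoning

    walk-edge : ∀ p → p < i + i → E (walk p) (walk (suc p)) ≡ true
    walk-edge p lt with suc p ≤? i
    ... | yes sp≤i = subst (λ z → E (walk p) z ≡ true) (sym (step-up p sp≤i))
                       (to-parent (walk p) (m>n⇒m∸n≢0 (≤-trans sp≤i i≤D) ∘ trans (sym (depth-walk-up p (≤-trans (n≤1+n p) sp≤i)))))
    ... | no sp≰i  = subst (λ z → E z (walk (suc p)) ≡ true) (sym (step-down p (≰⇒> sp≰i) lt))
                       (E-sym (to-parent (walk (suc p)) (m>n⇒m∸n≢0 index<D ∘ trans (sym (depth-walk-down (suc p) (≰⇒> sp≰i) lt)))))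
      where
      index<D : i + i ∸ suc p < D
      index<D = <-≤-trans (down-index< (suc p) (≰⇒> sp≰i) lt) i≤D

    cycle-via-edge : E v u ≡ true → Cycle E
    cycle-via-edge evu = closed-walk⇒cycle E (i′ + i′) walk
      (λ p q p≤ q≤ → walk-injective p q (subst (p ≤_) (sym 2i≡) p≤) (subst (q ≤_) (sym 2i≡) q≤))
      (λ p lt → walk-edge p (subst (p <_) (sym 2i≡) lt))
      (subst (λ z → E (walk z) (walk 0) ≡ true) 2i≡ (subst₂ (λ a b → E a b ≡ true) (sym walk-end) (sym walk-start) evu))

    cycle-via-child : E u beyond ≡ true → E beyond v ≡ true → depth beyond ≡ suc D → Cycle E
    cycle-via-child eux exv deep = closed-walk⇒cycle E (suc (i′ + i′)) walk
      (λ p q p≤ q≤ → injective′ p q (subst (p ≤_) (cong suc (sym 2i≡)) p≤) (subst (q ≤_) (cong suc (sym 2i≡)) q≤))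
      (λ p lt → edge′ p (subst (p <_) (cong suc (sym 2i≡)) lt))
      (subst (λ z → E (walk z) (walk 0) ≡ true) (cong suc 2i≡)
         (subst₂ (λ a b → E a b ≡ true) (sym walk-beyond) (sym walk-start) (E-sym eux)))
      where
      not-beyond : ∀ p → p ≤ i + i → walk p ≢ beyond
      not-beyond p le e = 1+n≰n (≤-trans (≤-reflexive (trans (sym deep) (cong depth (sym e)))) (depth-walk-≤ p le))
      injective′ : ∀ p q → p ≤ suc (i + i) → q ≤ suc (i + i) → walk p ≡ walk q → p ≡ q
      injective′ p q p≤ q≤ e with m≤n⇒m<n∨m≡n p≤ | m≤n⇒m<n∨m≡n q≤
      ... | inj₁ p< | inj₁ q<   = walk-injective p q (≤-pred p<) (≤-pred q<) e
      ... | inj₁ p< | inj₂ refl = ⊥-elim (not-beyond p (≤-pred p<) (trans e walk-beyond))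
      ... | inj₂ refl | inj₁ q< = ⊥-elim (not-beyond q (≤-pred q<) (trans (sym e) walk-beyond))
      ... | inj₂ refl | inj₂ refl = refl
      edge′ : ∀ p → p < suc (i + i) → E (walk p) (walk (suc p)) ≡ true
      edge′ p lt with m≤n⇒m<n∨m≡n (≤-pred lt)
      ... | inj₁ p< = walk-edge p p<
      ... | inj₂ refl = subst₂ (λ a b → E a b ≡ true) (sym walk-end) (sym walk-beyond) (E-sym exv)

  -- Distinct nodes of equal depth have ancestor chains that first meet at
  -- some level 1 ≤ i ≤ depth (they certainly meet at the centre).
  first-meeting : ∀ u v → u ≢ v → depth v ≡ depth u →
    Σ ℕ λ i′ → suc i′ ≤ depth u × up (suc i′) u ≡ up (suc i′) v × (∀ j → j < suc i′ → up j u ≢ up j v)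
  first-meeting u v u≢v same =
    meeting (least meets D) (least-holds meets D meet-at-D) (least-minimal meets D) (least-bounded meets D)
    where
    D = depth u
    meets : ℕ → Bool
    meets j = up j u == up j v
    meet-at-D : meets D ≡ true
    meet-at-D = does-complete (_ ≟ᶠ _) (trans (depth-zero _ (trans (depth-up D u) (n∸n≡0 D)))
                  (sym (depth-zero _ (trans (depth-up D v) (trans (cong (_∸ D) same) (n∸n≡0 D))))))
    meeting : ∀ i → meets i ≡ true → (∀ j → j < i → meets j ≡ false) → i ≤ D →
      Σ ℕ λ i′ → suc i′ ≤ D × up (suc i′) u ≡ up (suc i′) v × (∀ j → j < suc i′ → up j u ≢ up j v)
    meeting zero     hit _     _  = ⊥-elim (u≢v (does-sound (u ≟ᶠ v) hit))
    meeting (suc i′) hit below le = i′ , le , does-sound (_ ≟ᶠ _) hit ,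
                                    λ j lt e → true≢false (does-complete (_ ≟ᶠ _) e) (below j lt)

  same-depth-nonadjacent : ∀ u v → u ≢ v → depth v ≡ depth u → E u v ≡ true → ⊥
  same-depth-nonadjacent u v u≢v same euv with first-meeting u v u≢v same
  ... | i′ , i≤D , meet , first =
    acyclic T (UpDownWalk.cycle-via-edge u v u i′ same i≤D meet first (E-sym euv))

  unique-upper-neighbour : ∀ u v x → u ≢ v → depth v ≡ depth u →
    E u x ≡ true → E x v ≡ true → depth x ≡ suc (depth u) → ⊥
  unique-upper-neighbour u v x u≢v same eux exv deep with first-meeting u v u≢v same
  ... | i′ , i≤D , meet , first =
    acyclic T (UpDownWalk.cycle-via-child u v x i′ same i≤D meet first eux exv deep)

  deeper-end : ∀ a b → E a b ≡ true → depth a ≡ suc (depth b) → a ≢ c × b ≡ parent a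
  deeper-end a b e deep = a≢c , b≡parent
    where
    a≢c : a ≢ c
    a≢c = non-centre a (λ z → 0≢1+n (trans (sym z) deep))
    b≡parent : b ≡ parent a
    b≡parent with b ≟ᶠ parent a
    ... | yes p = p
    ... | no b≢p = ⊥-elim (unique-upper-neighbour b (parent a) a b≢p
                     (trans (depth-parent a) (cong (_∸ 1) deep)) (E-sym e) (parent-adj a a≢c) deep)

  edge-parent : ∀ a b → E a b ≡ true → (a ≢ c × b ≡ parent a) ⊎ (b ≢ c × a ≡ parent b)
  edge-parent a b e with <-cmp (depth a) (depth b)
  ... | tri≈ _ eq _ = ⊥-elim (same-depth-nonadjacent a b (λ { refl → true≢false e (tirrefl T a) }) (sym eq) e)
  ... | tri> _ _ gt = inj₁ (deeper-end a b e (≤-antisym (edge-depth a b e) gt))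
  ... | tri< lt _ _ = inj₂ (deeper-end b a (E-sym e) (≤-antisym (edge-depth b a (E-sym e)) lt))

module KeyOrder {n} {G : Graph n} (D : Decomposition G) (k : ℕ) (c : Fin (m D))
  (radius : ∀ a → WalkLe (tadj (tree D)) c a k) where

  T : Tree (m D)
  T = tree D
  open RootedTree T c k radius
  open TreeEdges T c k radius

  key : Fin (m D) → ℕ → ℕ
  key a j = if does (suc j ≤? depth a) then suc (toℕ (ancestor a (suc j))) else 0

  key-within : ∀ a j → suc j ≤ depth a → key a j ≡ suc (toℕ (ancestor a (suc j)))
  key-within a j le rewrite does-complete (suc j ≤? depth a) le = refl

  key-beyond : ∀ a j → ¬ suc j ≤ depth a → key a j ≡ 0
  key-beyond a j nle rewrite does-false (suc j ≤? depth a) nle = refl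

  same-ancestor⇒agree : ∀ a b j → j ≤ depth a → j ≤ depth b → ancestor a j ≡ ancestor b j →
    ∀ q → q < j → key a q ≡ key b q
  same-ancestor⇒agree a b j j≤a j≤b same q q<j = begin
      key a q                                      ≡⟨ key-within a q (≤-trans q<j j≤a) ⟩
      suc (toℕ (ancestor a (suc q)))               ≡⟨ cong entry (sym (ancestor-ancestor a (suc q) j q<j j≤a)) ⟩
      suc (toℕ (ancestor (ancestor a j) (suc q)))  ≡⟨ cong (λ z → entry (ancestor z (suc q))) same ⟩
      suc (toℕ (ancestor (ancestor b j) (suc q)))  ≡⟨ cong entry (ancestor-ancestor b (suc q) j q<j j≤b) ⟩
      suc (toℕ (ancestor b (suc q)))               ≡⟨ sym (key-within b q (≤-trans q<j j≤b)) ⟩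
      key b q                                      ∎
    where
    open ≡-Reasoning
    entry : Fin (m D) → ℕ
    entry z = suc (toℕ z)

  agree⇒same-ancestor : ∀ a b j → j ≤ depth b → (∀ q → q < j → key a q ≡ key b q) →
    j ≤ depth a × ancestor a j ≡ ancestor b j
  agree⇒same-ancestor a b zero    _   _     = z≤n , trans (ancestor-zero a) (sym (ancestor-zero b))
  agree⇒same-ancestor a b (suc q) j≤b agrees = j≤a , toℕ-injective (suc-injective
      (trans (sym (key-within a q j≤a)) (trans (agrees q ≤-refl) (key-within b q j≤b))))
    where
    j≤a : suc q ≤ depth a
    j≤a with suc q ≤? depth a
    ... | yes le = le
    ... | no nle = ⊥-elim (0≢1+n (trans (sym (key-beyond a q nle)) (trans (agrees q ≤-refl) (key-within b q j≤b))))

  -- a node deeper than another is told apart at the last level of the deeper one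
  key-separates-deeper : ∀ a b → depth a < depth b → Σ ℕ λ q → q < k × key a q ≢ key b q
  key-separates-deeper a b lt = at-depth (depth b) refl lt
    where
    at-depth : ∀ d → depth b ≡ d → depth a < d → Σ ℕ λ q → q < k × key a q ≢ key b q
    at-depth (suc q) eq lt = q , subst (_≤ k) eq (depth-≤k b) ,
      λ e → 0≢1+n (trans (sym (key-beyond a q (<⇒≱ lt))) (trans e (key-within b q (≤-reflexive (sym eq)))))

  key-separates : ∀ a b → a ≢ b → Σ ℕ λ q → q < k × key a q ≢ key b q
  key-separates a b a≢b with <-cmp (depth a) (depth b)
  ... | tri< lt _ _ = key-separates-deeper a b lt
  ... | tri> _ _ gt with key-separates-deeper b a gt
  ...   | q , q<k , ne = q , q<k , λ e → ne (sym e)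
  key-separates a b a≢b | tri≈ _ eq _ = same-depth (depth a) refl
    where
    -- at equal depth d = suc q the entries at q are the nodes themselves
    same-depth : ∀ d → depth a ≡ d → Σ ℕ λ q → q < k × key a q ≢ key b q
    same-depth zero    da = ⊥-elim (a≢b (trans (depth-zero a da) (sym (depth-zero b (trans (sym eq) da)))))
    same-depth (suc q) da = q , subst (_≤ k) da (depth-≤k a) , λ e → a≢b (begin
        a                      ≡⟨ sym (ancestor-self a) ⟩
        ancestor a (depth a)   ≡⟨ cong (ancestor a) da ⟩
        ancestor a (suc q)     ≡⟨ toℕ-injective (suc-injective (trans (sym (key-within a q (≤-reflexive (sym da))))
                                    (trans e (key-within b q db)))) ⟩
        ancestor b (suc q)     ≡⟨ cong (ancestor b) (trans (sym da) eq) ⟩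
        ancestor b (depth b)   ≡⟨ ancestor-self b ⟩
        b                      ∎)
      where
      open ≡-Reasoning
      db : suc q ≤ depth b
      db = ≤-reflexive (trans (sym da) eq)

  precedes : Fin n → Fin n → Bool
  precedes u v = lex k (key (σ D u)) (key (σ D v))

  precedes-total : ∀ u v → u ≢ v → precedes u v ≡ true ⊎ precedes v u ≡ true
  precedes-total u v u≢v with key-separates (σ D u) (σ D v) (λ e → u≢v (σ-inj D e))
  ... | q , q<k , differ = lex-total k _ _ q q<k differ

  open OrderingFrom precedes (λ u → lex-irrefl k _) (λ u v w → lex-trans k _ _ _) precedes-total public

  slice : Fin (m D) → ℕ → Fin (m D) → Bool
  slice ξ j a = agree j (key a) (key ξ) ∧ (key a j <ᵇ key ξ j)

  -- Apart from t itself, the slice is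
  -- the set of nodes `under` t through a child smaller than s, and this set
  -- is a union of components of T − t.
  module Branch (ξ : Fin (m D)) (j : ℕ) (j<depth : suc j ≤ depth ξ) where

    t s : Fin (m D)
    t = ancestor ξ j
    s = ancestor ξ (suc j)

    under : Fin (m D) → Bool
    under a = does (suc j ≤? depth a) ∧ ((ancestor a j == t) ∧ (toℕ (ancestor a (suc j)) <ᵇ toℕ s))

    under-elim : ∀ a → under a ≡ true → suc j ≤ depth a × ancestor a j ≡ t × toℕ (ancestor a (suc j)) < toℕ s
    under-elim a e = does-sound (_ ≤? _) (∧-projˡ e) ,
                     does-sound (_ ≟ᶠ _) (∧-projˡ (∧-projʳ {does (suc j ≤? depth a)} e)) ,
                     does-sound (_ <? _) (∧-projʳ {ancestor a j == t} (∧-projʳ {does (suc j ≤? depth a)} e))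

    under-intro : ∀ a → suc j ≤ depth a → ancestor a j ≡ t → toℕ (ancestor a (suc j)) < toℕ s → under a ≡ true
    under-intro a p q r =
      ∧-intro (does-complete (_ ≤? _) p) (∧-intro (does-complete (_ ≟ᶠ _) q) (does-complete (_ <? _) r))

    key-ξ : key ξ j ≡ suc (toℕ s)
    key-ξ = key-within ξ j j<depth

    slice⇒under : ∀ a → a ≢ t → slice ξ j a ≡ true → under a ≡ true
    slice⇒under a a≢t e = under-intro a deep (proj₂ base) smaller
      where
      base : j ≤ depth a × ancestor a j ≡ t
      base = agree⇒same-ancestor a ξ j (≤-trans (n≤1+n j) j<depth) (agree-sound j _ _ (∧-projˡ e))
      deep : suc j ≤ depth a
      deep = ≤∧≢⇒< (proj₁ base)
               (λ e′ → a≢t (trans (sym (ancestor-self a)) (trans (cong (ancestor a) (sym e′)) (proj₂ base))))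
      smaller : toℕ (ancestor a (suc j)) < toℕ s
      smaller = ≤-pred (subst₂ _<_ (key-within a j deep) key-ξ
                  (does-sound (_ <? _) (∧-projʳ {agree j (key a) (key ξ)} e)))

    under⇒slice : ∀ a → under a ≡ true → slice ξ j a ≡ true
    under⇒slice a e with under-elim a e
    ... | deep , same , smaller = ∧-intro
      (agree-complete j _ _ (same-ancestor⇒agree a ξ j (≤-trans (n≤1+n j) deep) (≤-trans (n≤1+n j) j<depth) same))
      (does-complete (_ <? _) (subst₂ _<_ (sym (key-within a j deep)) (sym key-ξ) (s≤s smaller)))

    slice≡under : ∀ a → a ≢ t → slice ξ j a ≡ under a
    slice≡under a a≢t = bool-ext (slice⇒under a a≢t) (under⇒slice a)

    under-parent : ∀ a → a ≢ c → parent a ≢ t → under a ≡ under (parent a)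
    under-parent a a≢c pa≢t = bool-ext going-up going-down
      where
      b = parent a
      deeper : depth a ≡ suc (depth b)
      deeper = depth-suc-parent a a≢c
      going-up : under a ≡ true → under b ≡ true
      going-up e with under-elim a e
      ... | deep , same , smaller with m≤n⇒m<n∨m≡n (≤-pred (subst (suc j ≤_) deeper deep))
      ...   | inj₂ j≡ = ⊥-elim (pa≢t (trans (sym (ancestor-self b)) (trans (cong (ancestor b) (sym j≡))
                          (trans (sym (ancestor-parent a j a≢c (≤-reflexive j≡))) same))))
      ...   | inj₁ j< = under-intro b j< (trans (sym (ancestor-parent a j a≢c (<⇒≤ j<)) ) same)
                          (subst (λ z → toℕ z < toℕ s) (ancestor-parent a (suc j) a≢c j<) smaller)
      going-down : under b ≡ true → under a ≡ true
      going-down e with under-elim b e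
      ... | deep , same , smaller = under-intro a (≤-trans deep (subst (depth b ≤_) (sym deeper) (n≤1+n _)))
              (trans (ancestor-parent a j a≢c (<⇒≤ deep)) same)
              (subst (λ z → toℕ z < toℕ s) (sym (ancestor-parent a (suc j) a≢c deep)) smaller)

    under-edge : ∀ a b → E a b ≡ true → a ≢ t → b ≢ t → under a ≡ under b
    under-edge a b e a≢t b≢t with edge-parent a b e
    ... | inj₁ (a≢c , refl) = under-parent a a≢c b≢t
    ... | inj₂ (b≢c , refl) = sym (under-parent b b≢c a≢t)

    start-avoids : ∀ {a b} → ConnAvoid E t a b → a ≢ t
    start-avoids (here ne)     = ne
    start-avoids (step ne _ _) = ne

    slice-connected : ∀ {a b} → ConnAvoid E t a b → slice ξ j a ≡ slice ξ j b
    slice-connected (here _) = refl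
    slice-connected (step {a} {a′} a≢t e rest) = begin
        slice ξ j a   ≡⟨ slice≡under a a≢t ⟩
        under a       ≡⟨ under-edge a a′ e a≢t (start-avoids rest) ⟩
        under a′      ≡⟨ sym (slice≡under a′ (start-avoids rest)) ⟩
        slice ξ j a′  ≡⟨ slice-connected rest ⟩
        slice ξ j _   ∎
      where open ≡-Reasoning

    -- if t is a leaf, the slice is contained in {t}: a further node would
    -- give t a second neighbour besides s
    slice-at-leaf : Leaf T t → ∀ a → slice ξ j a ≡ true → a ≡ t
    slice-at-leaf leaf a e with a ≟ᶠ t
    ... | yes a≡t = a≡t
    ... | no a≢t with under-elim a (slice⇒under a a≢t e)
    ...   | deep , same , smaller =
      ⊥-elim (<⇒≱ (count-pair (tadj T t) w s (subst (λ z → E z w ≡ true) same (ancestor-adj a j deep))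
                     (ancestor-adj ξ j j<depth) (λ w≡s → <-irrefl (cong toℕ w≡s) smaller)) (≤-reflexive leaf))
      where
      w = ancestor a (suc j)

  vertexSlice : Fin n → ℕ → Subset n
  vertexSlice x j v = slice (σ D x) j (σ D v)

  -- Every slice has cut-rank ≤ k: it is empty beyond the depth of ξ, a
  -- union of parts at the internal node t, or a single vertex if t is a leaf.
  slice-cutRank : WidthLe D k → ∀ x j → CutRankLe G (vertexSlice x j) k
  slice-cutRank width x j with suc j ≤? depth (σ D x)
  ... | no too-deep = cutRank-≤-size G _ k (≤-trans (≤-reflexive (count-empty _ nothing-below-zero)) z≤n)
    where
    nothing-below-zero : ∀ v → vertexSlice x j v ≡ false
    nothing-below-zero v = ¬true⇒false λ e → <⇒≱ (subst (key (σ D v) j <_) (key-beyond (σ D x) j too-deep)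
                             (does-sound (_ <? _) (∧-projʳ {agree j _ _} e))) z≤n
  ... | yes j<depth with degree T (ancestor (σ D x) j) ≟ 1
  ...   | no internal = width t internal _ (λ u v conn → slice-connected conn)
    where open Branch (σ D x) j j<depth
  ...   | yes leaf = cutRank-≤-size G _ k
                       (≤-trans (count-subsingleton _ only-t) (≤-trans (s≤s z≤n) (≤-trans j<depth (depth-≤k _))))
    where
    open Branch (σ D x) j j<depth
    only-t : ∀ u v → vertexSlice x j u ≡ true → vertexSlice x j v ≡ true → u ≡ v
    only-t u v eu ev = σ-inj D (trans (slice-at-leaf leaf _ eu) (sym (slice-at-leaf leaf _ ev)))

  -- Every proper prefix of the ordering is the union of the k slices of its
  -- successor, so it has cut-rank ≤ k · k.
  prefix-cutRank : WidthLe D k → ∀ i → suc i ≤ n → CutRankLe G (prefix ordering i) (k * k)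
  prefix-cutRank width i i<n with prefix-downset i i<n
  ... | x , prefix≡ = cutRank-cover G (prefix ordering i) (vertexSlice x) k k
    (λ j j<k v e → trans (prefix≡ v) (lex-join k _ _ j j<k (∧-projˡ e) (∧-projʳ {agree j _ _} e)))
    (λ v e → let (j , j<k , agrees , smaller) = lex-split k _ _ (trans (sym (prefix≡ v)) e)
             in j , j<k , ∧-intro agrees smaller)
    (λ j _ → slice-cutRank width x j)

proposition6p1 : ∀ {n} (G : Graph n) (k : ℕ) → RdLe G k → LrwLe G (k * k)
proposition6p1 G k (inj₁ n<2) =
  identity , λ i 1≤i i<n → ⊥-elim (<⇒≱ n<2 (≤-trans (s≤s 1≤i) i<n))
proposition6p1 G k (inj₂ (D , width , c , radius)) =
  ordering , λ i _ i<n → prefix-cutRank width i i<n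
  where open KeyOrder D k c radius
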